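{- Let $M:\sigma$ be a closed long $\beta\eta$-normal form of the $\lambda\Omega^+$-calculus. Then $t_\sigma(\mathcal{O}[\![M]\!])=\top$ if and only if $M$ is proper.
   Context: Simple types are built from a ground type $o$ with $\to$; write $\sigma_1\to\cdots\to\sigma_n\to o$ as $(\sigma_1,\ldots,\sigma_n)$. The $\lambda\Omega^+$-calculus is the typed (Church-style) $\lambda\beta\eta$-calculus extended with constants $\Omega_\sigma:\sigma$ for every type $\sigma$, with no additional conversion rules. A long $\beta\eta$-normal form is a $\beta$-normal form that is fully $\eta$-expanded; it is proper if it contains no constant $\Omega_\sigma$, and improper otherwise. Semantics: $\mathcal{O}_o=\{\perp,\top\}$ with $\perp\le\top$, and $\mathcal{O}_{\sigma\to\tau}$ is the (finite) poset of monotone functions $\mathcal{O}_\sigma\to\mathcal{O}_\tau$ ordered pointwise; typed $\lambda$-terms are interpreted in the standard way, with $\mathcal{O}[\![\Omega_\sigma]\!]=\perp_{\mathcal{O}_\sigma}$; $\mathcal{O}[\![M]\!]$ denotes the interpretation of a closed term. Test functions $t_\sigma:\mathcal{O}_\sigma\to\mathcal{O}_o$ and elements $s_\sigma\in\mathcal{O}_\sigma$ are defined by mutual induction: for $\sigma=(\sigma_1,\ldots,\sigma_n)$, $t_\sigma(f)=f\,s_{\sigma_1}\cdots s_{\sigma_n}$ and $s_\sigma f_1\ldots f_n=\bigwedge_{i}t_{\sigma_i}(f_i)$ (so $t_o(x)=x$ and $s_o=\top$). -}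

module Defs where

open import Data.Bool.Base using (Bool; true; false; _∧_; f≤t; b≤b)
  renaming (_≤_ to _≤B_)
open import Data.List.Base using (List; []; _∷_)
open import Data.Product.Base using (Σ; _×_; _,_; proj₁; proj₂)
open import Data.Unit.Base using (⊤; tt)
open import Data.Empty using (⊥)

-- Simple types over the ground type o.
-- The paper's (σ₁,…,σₙ) = σ₁ → ⋯ → σₙ → o is σ₁ ⇒ (⋯ ⇒ (σₙ ⇒ o)).

infixr 7 _⇒_
data Ty : Set where
  o   : Ty
  _⇒_ : Ty → Ty → Ty

-- Semantics: 𝒪_o = {⊥ ≤ ⊤} (⊥ = false, ⊤ = true),
-- 𝒪_{σ→τ} = monotone functions 𝒪_σ → 𝒪_τ, ordered pointwise.

mutual
  𝒪 : Ty → Set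
  𝒪 o       = Bool
  𝒪 (σ ⇒ τ) = Σ (𝒪 σ → 𝒪 τ) (λ f → ∀ {x y} → Le σ x y → Le τ (f x) (f y))

  Le : (σ : Ty) → 𝒪 σ → 𝒪 σ → Set
  Le o       x y = x ≤B y
  Le (σ ⇒ τ) f g = ∀ x → Le τ (proj₁ f x) (proj₁ g x)

_·_ : ∀ {σ τ} → 𝒪 (σ ⇒ τ) → 𝒪 σ → 𝒪 τ
f · x = proj₁ f x

Le-refl : ∀ σ {x} → Le σ x x
Le-refl o       = b≤b
Le-refl (σ ⇒ τ) = λ x → Le-refl τ

Le-trans : ∀ σ {x y z} → Le σ x y → Le σ y z → Le σ x z
Le-trans o b≤b q = q
Le-trans o f≤t b≤b = f≤t
Le-trans (σ ⇒ τ) p q = λ x → Le-trans τ (p x) (q x)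

bot : ∀ σ → 𝒪 σ
bot o       = false
bot (σ ⇒ τ) = (λ _ → bot τ) , (λ _ → Le-refl τ)

-- For σ = (σ₁,…,σₙ):  t_σ(f) = f s_{σ₁} ⋯ s_{σₙ},
--                      s_σ f₁ … fₙ = ⋀ᵢ t_{σᵢ}(fᵢ).
-- Curried: t_{σ⇒τ}(f) = t_τ(f s_σ), and s_σ = sAcc σ ⊤ where
-- sAcc (σ⇒τ) b f = sAcc τ (b ∧ t_σ f), sAcc o b = b
-- (so s_σ f₁ … fₙ = ⊤ ∧ t(f₁) ∧ ⋯ ∧ t(fₙ)).

∧-mono : ∀ {a a' b b'} → a ≤B a' → b ≤B b' → (a ∧ b) ≤B (a' ∧ b')
∧-mono {false} {false} _ _ = b≤b
∧-mono {false} {true} {false} {false} _ _ = b≤b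
∧-mono {false} {true} {false} {true} _ _ = f≤t
∧-mono {false} {true} {true} {true} _ _ = f≤t
∧-mono {true} {true} _ q = q
∧-mono {true} {false} () _

mutual
  t : ∀ σ → 𝒪 σ → Bool
  t o       x = x
  t (σ ⇒ τ) f = t τ (f · s σ)

  s : ∀ σ → 𝒪 σ
  s σ = sAcc σ true

  sAcc : ∀ σ → Bool → 𝒪 σ
  sAcc o       b = b
  sAcc (σ ⇒ τ) b =
    (λ f → sAcc τ (b ∧ t σ f)) ,
    (λ p → sAcc-mono τ (∧-mono {b} {b} b≤b (t-mono σ p)))

  t-mono : ∀ σ {x y} → Le σ x y → t σ x ≤B t σ y
  t-mono o       p = p
  t-mono (σ ⇒ τ) p = t-mono τ (p (s σ))

  sAcc-mono : ∀ σ {b b'} → b ≤B b' → Le σ (sAcc σ b) (sAcc σ b')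
  sAcc-mono o       p = p
  sAcc-mono (σ ⇒ τ) p = λ f → sAcc-mono τ (∧-mono p b≤b)

Ctx : Set
Ctx = List Ty

data _∋_ : Ctx → Ty → Set where
  here  : ∀ {Γ σ} → (σ ∷ Γ) ∋ σ
  there : ∀ {Γ σ τ} → Γ ∋ σ → (τ ∷ Γ) ∋ σ

data Tm (Γ : Ctx) : Ty → Set where
  var : ∀ {σ} → Γ ∋ σ → Tm Γ σ
  lam : ∀ {σ τ} → Tm (σ ∷ Γ) τ → Tm Γ (σ ⇒ τ)
  app : ∀ {σ τ} → Tm Γ (σ ⇒ τ) → Tm Γ σ → Tm Γ τ
  Ω   : ∀ σ → Tm Γ σ

-- Long βη-normal forms:  λx₁…xₙ. h N₁ … Nₖ  of ground body type o,
-- with head h a variable or a constant Ω_τ and each Nᵢ long normal.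

mutual
  data Nf {Γ : Ctx} : ∀ {σ} → Tm Γ σ → Set where
    nf-lam : ∀ {σ τ} {M : Tm (σ ∷ Γ) τ} → Nf M → Nf (lam M)
    nf-ne  : {M : Tm Γ o} → Ne M → Nf M

  data Ne {Γ : Ctx} : ∀ {σ} → Tm Γ σ → Set where
    ne-var : ∀ {σ} (x : Γ ∋ σ) → Ne (var x)
    ne-Ω   : ∀ σ → Ne (Ω σ)
    ne-app : ∀ {σ τ} {M : Tm Γ (σ ⇒ τ)} {N : Tm Γ σ} → Ne M → Nf N → Ne (app M N)

Proper : ∀ {Γ σ} → Tm Γ σ → Set
Proper (var x)   = ⊤
Proper (lam M)   = Proper M
Proper (app M N) = Proper M × Proper N
Proper (Ω σ)     = ⊥

Env : Ctx → Set
Env []      = ⊤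
Env (σ ∷ Γ) = 𝒪 σ × Env Γ

LeEnv : ∀ Γ → Env Γ → Env Γ → Set
LeEnv []      _ _ = ⊤
LeEnv (σ ∷ Γ) (d , ρ) (d' , ρ') = Le σ d d' × LeEnv Γ ρ ρ'

LeEnv-refl : ∀ Γ {ρ} → LeEnv Γ ρ ρ
LeEnv-refl []      = tt
LeEnv-refl (σ ∷ Γ) = Le-refl σ , LeEnv-refl Γ

lookup : ∀ {Γ σ} → Γ ∋ σ → Env Γ → 𝒪 σ
lookup here      (d , ρ) = d
lookup (there x) (d , ρ) = lookup x ρ

lookup-mono : ∀ {Γ σ} (x : Γ ∋ σ) {ρ ρ'} → LeEnv Γ ρ ρ' → Le σ (lookup x ρ) (lookup x ρ')
lookup-mono here      (p , _) = p
lookup-mono (there x) (_ , q) = lookup-mono x q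

mutual
  eval : ∀ {Γ σ} → Tm Γ σ → Env Γ → 𝒪 σ
  eval (var x)   ρ = lookup x ρ
  eval {Γ} (lam {σ} M) ρ =
    (λ d → eval M (d , ρ)) , (λ p → eval-mono M (p , LeEnv-refl Γ))
  eval (app M N) ρ = eval M ρ · eval N ρ
  eval (Ω σ)     ρ = bot σ

  eval-mono : ∀ {Γ σ} (M : Tm Γ σ) {ρ ρ'} → LeEnv Γ ρ ρ' →
              Le σ (eval M ρ) (eval M ρ')
  eval-mono (var x)   p = lookup-mono x p
  eval-mono (lam M)   p = λ d → eval-mono M (Le-refl _ , p)
  eval-mono {σ = τ} (app M N) {ρ} {ρ'} p =
    Le-trans τ (proj₂ (eval M ρ) (eval-mono N p)) (eval-mono M p (eval N ρ'))
  eval-mono (Ω σ)     p = Le-refl σ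

⟦_⟧ : ∀ {σ} → Tm [] σ → 𝒪 σ
⟦ M ⟧ = eval M tt

{-# OPTIONS --safe #-}
module Submission where

-- Evaluate open normal forms in the environment that sends every variable
-- x : σ to s_σ.  A variable-headed neutral term x N₁ … Nₖ of type τ then
-- denotes sAcc τ (t(N₁) ∧ ⋯ ∧ t(Nₖ)), and an Ω-headed one denotes ⊥_τ, which
-- acts like sAcc τ false.  So every neutral term denotes sAcc τ b for a
-- boolean b that holds exactly when the term is proper, and testing a normal
-- form reduces, under its λs, to reading off this b at ground type.

open import Defs
open import Data.Bool.Base using (Bool; true; false; _∧_; T)
open import Data.Bool.Properties using (T-≡; T-∧)
open import Data.List.Base using ([]; _∷_)
open import Data.Product.Base using (Σ; _×_; _,_)
open import Data.Product.Function.NonDependent.Propositional using (_×-⇔_)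
open import Data.Unit.Base using (tt)
open import Relation.Binary.PropositionalEquality using (_≡_; refl; sym; subst)
open import Function.Bundles using (_⇔_; mk⇔)
import Function.Properties.Equivalence as ⇔

ExtEq : (τ : Ty) → 𝒪 τ → 𝒪 τ → Set
ExtEq o       x y = x ≡ y
ExtEq (σ ⇒ τ) f g = ∀ d → ExtEq τ (f · d) (g · d)

≡⇒ExtEq : ∀ τ {x y} → x ≡ y → ExtEq τ x y
≡⇒ExtEq o       x≡y  = x≡y
≡⇒ExtEq (σ ⇒ τ) refl = λ _ → ≡⇒ExtEq τ refl

bot-ExtEq-sAcc-false : ∀ τ → ExtEq τ (bot τ) (sAcc τ false)
bot-ExtEq-sAcc-false o       = refl
bot-ExtEq-sAcc-false (σ ⇒ τ) = λ _ → bot-ExtEq-sAcc-false τ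

sEnv : ∀ Γ → Env Γ
sEnv []      = tt
sEnv (σ ∷ Γ) = s σ , sEnv Γ

lookup-sEnv : ∀ {Γ σ} (x : Γ ∋ σ) → lookup x (sEnv Γ) ≡ s σ
lookup-sEnv here      = refl
lookup-sEnv (there x) = lookup-sEnv x

NeutralValue : ∀ {Γ τ} → Tm Γ τ → Set
NeutralValue {Γ} {τ} M =
  Σ Bool λ b → ExtEq τ (eval M (sEnv Γ)) (sAcc τ b) × (T b ⇔ Proper M)

mutual
  t-eval-sEnv⇔Proper : ∀ {Γ σ} {M : Tm Γ σ} → Nf M →
                        T (t σ (eval M (sEnv Γ))) ⇔ Proper M
  t-eval-sEnv⇔Proper (nf-lam n) = t-eval-sEnv⇔Proper n
  t-eval-sEnv⇔Proper (nf-ne n) with neutralValue n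
  ... | b , value≡b , b⇔proper = subst (λ v → T v ⇔ _) (sym value≡b) b⇔proper

  neutralValue : ∀ {Γ τ} {M : Tm Γ τ} → Ne M → NeutralValue M
  neutralValue {τ = τ} (ne-var x) =
    true , ≡⇒ExtEq τ (lookup-sEnv x) , mk⇔ (λ _ → tt) (λ _ → tt)
  neutralValue (ne-Ω σ) = false , bot-ExtEq-sAcc-false σ , mk⇔ (λ ()) (λ ())
  neutralValue {Γ} (ne-app {σ} {N = N} m n) with neutralValue m
  ... | b , value≈b , b⇔proper =
    b ∧ t σ (eval N (sEnv Γ)) , value≈b (eval N (sEnv Γ))
      , ⇔.trans T-∧ (b⇔proper ×-⇔ t-eval-sEnv⇔Proper n)

lemma4 : (σ : Ty) (M : Tm [] σ) → Nf M →
    ((t σ ⟦ M ⟧ ≡ true) ⇔ Proper M)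
lemma4 σ M n = ⇔.trans (⇔.sym T-≡) (t-eval-sEnv⇔Proper n)
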